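{- Let $R$ be a finite commutative ring with identity such that $\Gamma(R)$ is a complete graph, and let $F$ be a finite field with $|F|\geq 3$. Then $$\gamma^o(\Gamma(F \times R)) = |Z(R)^*| + \min \left\{ |U(R)|,\ |F^*|,\ 2 + \left\lfloor \frac{|U(R)|-|Z(R)^*|}{2} \right\rfloor + \left\lfloor \frac{|F^*|}{2} \right\rfloor \right\}.$$
   Context: $Z(R)^*$ denotes the set of nonzero zero-divisors of $R$, $U(R)$ the set of units of $R$, and $F^*=F\setminus\{0\}$. The zero-divisor graph $\Gamma(R)$ is the simple graph with vertex set $Z(R)^*$, in which distinct $u,v$ are adjacent if and only if $uv=0$. For a simple graph $\Gamma=(V,E)$, a set $S\subseteq V$ and a vertex $v$, let $\delta_S(v)$ be the number of neighbors of $v$ in $S$ and $\overline{S}=V\setminus S$. A nonempty set $S\subseteq V$ is a global offensive alliance if $\delta_S(v)\geq \delta_{\overline{S}}(v)+1$ for every $v\in\overline{S}$. $\gamma^o(\Gamma)$ is the minimum cardinality of a global offensive alliance of $\Gamma$. -}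

module Defs where

open import Level using (0ℓ)
open import Algebra.Bundles using (CommutativeRing)
import Algebra.Construct.DirectProduct as DP
open import Data.Nat as ℕ using (ℕ; _≤_)
open import Data.Integer as ℤ using (ℤ; +_; _⊓_; _/ℕ_)
open import Data.Fin using (Fin; combine; remQuot)
open import Data.Fin.Properties using (_≟_; any?; remQuot-combine; combine-remQuot)
open import Data.Fin.Subset using (Subset; _∈_; _∉_; ∣_∣)
open import Data.Fin.Subset.Properties using (_∈?_)
open import Data.List using (List; length; filter)
open import Data.List.Base using (allFin)
open import Data.Product using (Σ; ∃; _×_; _,_; proj₁; proj₂; uncurry)
open import Relation.Nullary using (¬_; Dec; yes; no; contradiction)
open import Relation.Nullary.Decidable using (¬?; _×-dec_)
open import Relation.Binary.PropositionalEquality as P using (_≡_)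

record Finite (R : CommutativeRing 0ℓ 0ℓ) : Set where
  open CommutativeRing R
  field
    size       : ℕ
    index      : Carrier → Fin size
    elem       : Fin size → Carrier
    elem-index : ∀ x → elem (index x) ≈ x
    index-elem : ∀ i → index (elem i) ≡ i
    index-cong : ∀ {x y} → x ≈ y → index x ≡ index y

record FinCommRing : Set₁ where
  field
    cring  : CommutativeRing 0ℓ 0ℓ
    finite : Finite cring
  open CommutativeRing cring public
  open Finite finite public
  field
    1≉0 : ¬ (1# ≈ 0#)

  _≈?_ : ∀ x y → Dec (x ≈ y)
  x ≈? y with index x ≟ index y
  ... | yes p = yes (trans (sym (elem-index x))
                  (trans (reflexive (P.cong elem p)) (elem-index y)))
  ... | no ¬p = no λ q → ¬p (index-cong q)

  IsZD* : Carrier → Set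
  IsZD* x = ¬ (x ≈ 0#) × ∃ λ y → ¬ (y ≈ 0#) × (x * y ≈ 0#)

  IsUnit : Carrier → Set
  IsUnit x = ∃ λ y → x * y ≈ 1#

  isZD*? : ∀ x → Dec (IsZD* x)
  isZD*? x with ¬? (x ≈? 0#) | any? (λ j → ¬? (elem j ≈? 0#) ×-dec ((x * elem j) ≈? 0#))
  ... | no p  | _ = no λ z → p (proj₁ z)
  ... | yes p | yes (j , q) = yes (p , elem j , q)
  ... | yes p | no ¬q = no λ { (_ , y , y≉0 , xy≈0) →
          ¬q (index y , (λ e → y≉0 (trans (sym (elem-index y)) e))
                      , trans (*-cong refl (elem-index y)) xy≈0) }

  isUnit? : ∀ x → Dec (IsUnit x)
  isUnit? x with any? (λ j → (x * elem j) ≈? 1#)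
  ... | yes (j , q) = yes (elem j , q)
  ... | no ¬q = no λ { (y , e) → ¬q (index y , trans (*-cong refl (elem-index y)) e) }

  |Z*| : ℕ
  |Z*| = length (filter (λ i → isZD*? (elem i)) (allFin size))

  |U| : ℕ
  |U| = length (filter (λ i → isUnit? (elem i)) (allFin size))

  |nonzero| : ℕ
  |nonzero| = length (filter (λ i → ¬? (elem i ≈? 0#)) (allFin size))

  ΓComplete : Set
  ΓComplete = ∀ x y → IsZD* x → IsZD* y → ¬ (x ≈ y) → x * y ≈ 0#

  Vertex : Fin size → Set
  Vertex i = IsZD* (elem i)

  Adj : Fin size → Fin size → Set
  Adj i j = Vertex i × Vertex j × ¬ (i ≡ j) × (elem i * elem j ≈ 0#)

  adj? : ∀ i j → Dec (Adj i j)
  adj? i j = isZD*? (elem i) ×-dec (isZD*? (elem j) ×-dec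
             (¬? (i ≟ j) ×-dec ((elem i * elem j) ≈? 0#)))

  δ : Subset size → Fin size → ℕ
  δ S v = length (filter (λ j → j ∈? S ×-dec adj? v j) (allFin size))

  δ̄ : Subset size → Fin size → ℕ
  δ̄ S v = length (filter (λ j → ¬? (j ∈? S) ×-dec adj? v j) (allFin size))

  IsGOA : Subset size → Set
  IsGOA S = (∀ i → i ∈ S → Vertex i)
          × (∃ λ i → i ∈ S)
          × (∀ v → Vertex v → v ∉ S → ℕ.suc (δ̄ S v) ≤ δ S v)

  γᵒ≡ : ℕ → Set
  γᵒ≡ m = (∃ λ S → IsGOA S × ∣ S ∣ ≡ m) × (∀ S → IsGOA S → m ≤ ∣ S ∣)

IsField : FinCommRing → Set
IsField F = ∀ x → ¬ (x ≈ 0#) → ∃ λ y → x * y ≈ 1#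
  where open FinCommRing F

module _ (A B : FinCommRing) where
  private
    module A = FinCommRing A
    module B = FinCommRing B

  prodFinite : Finite (DP.commutativeRing A.cring B.cring)
  prodFinite = record
    { size       = A.size ℕ.* B.size
    ; index      = λ { (a , b) → combine (A.index a) (B.index b) }
    ; elem       = λ k → let (i , j) = remQuot {A.size} B.size k in (A.elem i , B.elem j)
    ; elem-index = λ { (a , b) → elemIdx a b }
    ; index-elem = λ k → P.trans
        (P.cong₂ combine (A.index-elem (proj₁ (remQuot {A.size} B.size k)))
                         (B.index-elem (proj₂ (remQuot {A.size} B.size k))))
        (combine-remQuot {A.size} B.size k)
    ; index-cong = λ { {a , b} {a' , b'} (p , q) →
                       P.cong₂ combine (A.index-cong p) (B.index-cong q) }
    }
    where
    elemIdx : ∀ a b → let (i , j) = remQuot B.size (combine (A.index a) (B.index b))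
                      in (A.elem i A.≈ a) × (B.elem j B.≈ b)
    elemIdx a b =
      let e = remQuot-combine {A.size} {B.size} (A.index a) (B.index b) in
      A.trans (A.reflexive (P.cong (λ p → A.elem (proj₁ p)) e)) (A.elem-index a) ,
      B.trans (B.reflexive (P.cong (λ p → B.elem (proj₂ p)) e)) (B.elem-index b)

  _×R_ : FinCommRing
  _×R_ = record
    { cring  = DP.commutativeRing A.cring B.cring
    ; finite = prodFinite
    ; 1≉0    = λ { (p , _) → A.1≉0 p }
    }

-- The vertices (a, b) of Γ(F × R) fall into four classes: F*×0, 0×U(R), 0×Z(R)* and F*×Z(R)*.
-- As F is a field, F*×0 is adjacent exactly to 0×U ∪ 0×Z*, 0×U exactly to F*×0, F*×Z* only to
-- 0×Z*, and, Γ(R) being complete, (0, y) ∈ 0×Z* to F*×0 and to every vertex whose second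
-- coordinate is a zero-divisor other than y.  Write n = |F*|, u = |U(R)|, z = |Z(R)*|.
-- A global offensive alliance S has at least z vertices in 0×Z* ∪ F*×Z*: a vertex of 0×Z*
-- outside S has to be paid for by the offensive condition there or at a vertex of F*×Z*.
-- Moreover S contains F*×0, or contains 0×U, or misses a vertex of each, and then the offensive
-- condition at those two vertices forces |S ∩ F*×0| ≥ ⌊n/2⌋ + 1 and |S ∩ 0×U| ≥ ⌊(u + 2 − z)/2⌋.
-- Conversely 0×Z* together with the cheapest of these three choices is an alliance.
-- When z ≥ 3, completeness forces x² = 0 on Z(R)*, so x ↦ 1 + x embeds Z(R)* into U(R); hence
-- z ≤ u + 2, which is what turns the count into the integer formula of the statement.

module Submission where

open import Defs
open import Data.Nat using (ℕ; _≤_)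

module Counting where

  open import Level using (0ℓ)
  open import Function using (_∘_; id)
  open import Data.Nat using (ℕ; zero; suc; _+_; _*_; _≤_; z≤n; s≤s)
  open import Data.Nat.Properties
    using (≤-trans; ≤-reflexive; ≤-antisym; m≤n⇒m≤1+n; +-suc; +-comm; +-monoʳ-≤; ≤-pred; module ≤-Reasoning)
  open import Data.Fin using (Fin; zero; suc; _↑ˡ_; _↑ʳ_; remQuot)
  open import Data.Fin.Properties using (_≟_; suc-injective; 0≢1+n; remQuot-combine; combine-remQuot)
  open import Data.Fin.Subset using (Subset; _∈_; _∉_; ∣_∣; inside; outside)
  open import Data.Fin.Subset.Properties using (_∈?_)
  open import Data.Vec.Base using ([]; _∷_; here; there)
  open import Data.List using (length; filter; tabulate)
  open import Data.List.Base using (allFin)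
  open import Data.Product using (∃; _×_; _,_; proj₁; proj₂; map₁)
  open import Relation.Nullary using (¬_; yes; no; contradiction)
  open import Relation.Unary using (Pred; Decidable; _⊆′_)
  open import Relation.Unary.Properties using (_∩?_; _∪?_; ∁?; _×?_)
  open import Relation.Binary.PropositionalEquality


  count : ∀ {N} {P : Pred (Fin N) 0ℓ} → Decidable P → ℕ
  count {zero}  P? = 0
  count {suc N} P? with P? zero
  ... | yes _ = suc (count (P? ∘ suc))
  ... | no  _ = count (P? ∘ suc)

  length-filter-tabulate : ∀ {A : Set} {N} {P : Pred A 0ℓ} (P? : Decidable P) (g : Fin N → A) →
                           length (filter P? (tabulate g)) ≡ count (P? ∘ g)
  length-filter-tabulate {N = zero}  P? g = refl
  length-filter-tabulate {N = suc N} P? g with P? (g zero)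
  ... | yes _ = cong suc (length-filter-tabulate P? (g ∘ suc))
  ... | no  _ = length-filter-tabulate P? (g ∘ suc)

  length-filter-allFin : ∀ {N} {P : Pred (Fin N) 0ℓ} (P? : Decidable P) → length (filter P? (allFin N)) ≡ count P?
  length-filter-allFin P? = length-filter-tabulate P? id

  count-mono : ∀ {N} {P Q : Pred (Fin N) 0ℓ} (P? : Decidable P) (Q? : Decidable Q) → P ⊆′ Q → count P? ≤ count Q?
  count-mono {N = zero}  P? Q? P⊆Q = z≤n
  count-mono {N = suc N} P? Q? P⊆Q with P? zero | Q? zero
  ... | yes p | yes _  = s≤s (count-mono (P? ∘ suc) (Q? ∘ suc) (P⊆Q ∘ suc))
  ... | yes p | no ¬q  = contradiction (P⊆Q zero p) ¬q
  ... | no _  | yes _  = m≤n⇒m≤1+n (count-mono (P? ∘ suc) (Q? ∘ suc) (P⊆Q ∘ suc))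
  ... | no _  | no _   = count-mono (P? ∘ suc) (Q? ∘ suc) (P⊆Q ∘ suc)

  count-cong : ∀ {N} {P Q : Pred (Fin N) 0ℓ} (P? : Decidable P) (Q? : Decidable Q) →
               P ⊆′ Q → Q ⊆′ P → count P? ≡ count Q?
  count-cong P? Q? P⊆Q Q⊆P = ≤-antisym (count-mono P? Q? P⊆Q) (count-mono Q? P? Q⊆P)

  count-none : ∀ {N} {P : Pred (Fin N) 0ℓ} (P? : Decidable P) → (∀ i → ¬ P i) → count P? ≡ 0
  count-none {N = zero}  P? ¬P = refl
  count-none {N = suc N} P? ¬P with P? zero
  ... | yes p = contradiction p (¬P zero)
  ... | no  _ = count-none (P? ∘ suc) (¬P ∘ suc)

  count-all : ∀ {N} {P : Pred (Fin N) 0ℓ} (P? : Decidable P) → (∀ i → P i) → count P? ≡ N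
  count-all {N = zero}  P? allP = refl
  count-all {N = suc N} P? allP with P? zero
  ... | yes _ = cong suc (count-all (P? ∘ suc) (allP ∘ suc))
  ... | no ¬p = contradiction (allP zero) ¬p

  count-split : ∀ {N} {P Q : Pred (Fin N) 0ℓ} (P? : Decidable P) (Q? : Decidable Q) →
                count P? ≡ count (P? ∩? Q?) + count (P? ∩? ∁? Q?)
  count-split {N = zero}  P? Q? = refl
  count-split {N = suc N} P? Q? with P? zero | Q? zero
  ... | yes _ | yes _ = cong suc (count-split (P? ∘ suc) (Q? ∘ suc))
  ... | yes _ | no  _ = trans (cong suc (count-split (P? ∘ suc) (Q? ∘ suc))) (sym (+-suc _ _))
  ... | no  _ | yes _ = count-split (P? ∘ suc) (Q? ∘ suc)
  ... | no  _ | no  _ = count-split (P? ∘ suc) (Q? ∘ suc)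

  count-∪ : ∀ {N} {P Q : Pred (Fin N) 0ℓ} (P? : Decidable P) (Q? : Decidable Q) → (∀ i → P i → ¬ Q i) →
            count (P? ∪? Q?) ≡ count P? + count Q?
  count-∪ {N = zero}  P? Q? disj = refl
  count-∪ {N = suc N} P? Q? disj with P? zero | Q? zero
  ... | yes p | yes q = contradiction q (disj zero p)
  ... | yes _ | no  _ = cong suc (count-∪ (P? ∘ suc) (Q? ∘ suc) (disj ∘ suc))
  ... | no  _ | yes _ = trans (cong suc (count-∪ (P? ∘ suc) (Q? ∘ suc) (disj ∘ suc))) (sym (+-suc _ _))
  ... | no  _ | no  _ = count-∪ (P? ∘ suc) (Q? ∘ suc) (disj ∘ suc)

  1≤count⇒∃ : ∀ {N} {P : Pred (Fin N) 0ℓ} (P? : Decidable P) → 1 ≤ count P? → ∃ P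
  1≤count⇒∃ {N = suc N} P? 1≤c with P? zero
  ... | yes p = zero , p
  ... | no  _ = let (i , p) = 1≤count⇒∃ (P? ∘ suc) 1≤c in suc i , p

  count-≟ : ∀ {N} (t : Fin N) → count (_≟ t) ≡ 1
  count-≟ {suc N} zero    = cong suc (count-none {N} (λ i → suc i ≟ zero) λ i ())
  count-≟ {suc N} (suc t) = trans (count-cong (λ i → suc i ≟ suc t) (_≟ t) (λ i → suc-injective) (λ i → cong suc))
                                  (count-≟ t)

  count-remove : ∀ {N} {P : Pred (Fin N) 0ℓ} (P? : Decidable P) (t : Fin N) → P t →
                 count P? ≡ suc (count (P? ∩? ∁? (_≟ t)))
  count-remove {P = P} P? t pt = begin
    count P?                                          ≡⟨ count-split P? (_≟ t) ⟩
    count (P? ∩? (_≟ t)) + count (P? ∩? ∁? (_≟ t))    ≡⟨ cong (_+ count (P? ∩? ∁? (_≟ t))) only-t ⟩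
    suc (count (P? ∩? ∁? (_≟ t)))                     ∎
    where
    open ≡-Reasoning
    at-t : ∀ i → i ≡ t → P i × i ≡ t
    at-t i refl = pt , refl
    only-t : count (P? ∩? (_≟ t)) ≡ 1
    only-t = trans (count-cong (P? ∩? (_≟ t)) (_≟ t) (λ i → proj₂) at-t) (count-≟ t)

  ∃⇒1≤count : ∀ {N} {P : Pred (Fin N) 0ℓ} (P? : Decidable P) (i : Fin N) → P i → 1 ≤ count P?
  ∃⇒1≤count P? i p = ≤-trans (s≤s z≤n) (≤-reflexive (sym (count-remove P? i p)))

  count-unique : ∀ {N} {P : Pred (Fin N) 0ℓ} (P? : Decidable P) (t : Fin N) → P t →
                 (∀ i → P i → i ≡ t) → count P? ≡ 1
  count-unique P? t pt unique =
    trans (count-remove P? t pt) (cong suc (count-none (P? ∩? ∁? (_≟ t)) λ i (p , i≢t) → i≢t (unique i p)))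

  count-injective : ∀ {N M} {P : Pred (Fin N) 0ℓ} {Q : Pred (Fin M) 0ℓ}
    (P? : Decidable P) (Q? : Decidable Q) (f : Fin N → Fin M) →
    (∀ i j → P i → P j → f i ≡ f j → i ≡ j) → (∀ i → P i → Q (f i)) → count P? ≤ count Q?
  count-injective {N = zero}  P? Q? f inj maps = z≤n
  count-injective {N = suc N} P? Q? f inj maps with P? zero
  ... | no  _  = count-injective (P? ∘ suc) Q? (f ∘ suc)
                   (λ i j p q e → suc-injective (inj (suc i) (suc j) p q e)) (maps ∘ suc)
  ... | yes p₀ = begin
    suc (count (P? ∘ suc))               ≤⟨ s≤s (count-injective (P? ∘ suc) (Q? ∩? ∁? (_≟ f zero)) (f ∘ suc)
                                                (λ i j p q e → suc-injective (inj (suc i) (suc j) p q e))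
                                                (λ i p → maps (suc i) p ,
                                                         λ e → 0≢1+n (inj zero (suc i) p₀ p (sym e)))) ⟩
    suc (count (Q? ∩? ∁? (_≟ f zero)))   ≡⟨ sym (count-remove Q? (f zero) (maps zero p₀)) ⟩
    count Q?                             ∎
    where open ≤-Reasoning

  count-↑ : ∀ m {n} {P : Pred (Fin (m + n)) 0ℓ} (P? : Decidable P) →
            count P? ≡ count (P? ∘ (_↑ˡ n)) + count (P? ∘ (m ↑ʳ_))
  count-↑ zero    P? = refl
  count-↑ (suc m) P? with P? zero
  ... | yes _ = cong suc (count-↑ m (P? ∘ suc))
  ... | no  _ = count-↑ m (P? ∘ suc)

  count-∘-≗ : ∀ {A : Set} {N} {P : Pred A 0ℓ} (P? : Decidable P) {f g : Fin N → A} →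
              f ≗ g → count (P? ∘ f) ≡ count (P? ∘ g)
  count-∘-≗ {P = P} P? f≗g = count-cong (P? ∘ _) (P? ∘ _) (λ i → subst P (f≗g i)) (λ i → subst P (sym (f≗g i)))

  count-×-suc : ∀ m n {P : Pred (Fin (suc m)) 0ℓ} {Q : Pred (Fin n) 0ℓ} (P? : Decidable P) (Q? : Decidable Q) →
    count ((P? ×? Q?) ∘ remQuot {suc m} n)
      ≡ count ((P? ×? Q?) ∘ (zero ,_)) + count ((P? ∘ suc ×? Q?) ∘ remQuot {m} n)
  count-×-suc m n P? Q? = trans (count-↑ n ((P? ×? Q?) ∘ remQuot {suc m} n))
    (cong₂ _+_ (count-∘-≗ (P? ×? Q?) (remQuot-combine zero))
               (count-∘-≗ (P? ×? Q?) remQuot-↑ʳ))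
    where
    remQuot-↑ʳ : ∀ k → remQuot {suc m} n (n ↑ʳ k) ≡ map₁ suc (remQuot {m} n k)
    remQuot-↑ʳ k = let (i , j) = remQuot {m} n k in trans
      (cong (remQuot {suc m} n ∘ (n ↑ʳ_)) (sym (combine-remQuot {m} n k)))
      (remQuot-combine (suc i) j)

  count-× : ∀ m n {P : Pred (Fin m) 0ℓ} {Q : Pred (Fin n) 0ℓ} (P? : Decidable P) (Q? : Decidable Q) →
            count ((P? ×? Q?) ∘ remQuot {m} n) ≡ count P? * count Q?
  count-× zero    n P? Q? = refl
  count-× (suc m) n P? Q? with P? zero
  ... | yes p = trans (count-×-suc m n P? Q?)
    (cong₂ _+_ (count-cong _ Q? (λ j → proj₂) (λ j q → p , q)) (count-× m n (P? ∘ suc) Q?))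
  ... | no ¬p = trans (count-×-suc m n P? Q?)
    (cong₂ _+_ (count-none ((P? ×? Q?) ∘ (zero ,_)) (λ j → ¬p ∘ proj₁)) (count-× m n (P? ∘ suc) Q?))

  count-∈-∷ : ∀ {N} x (S : Subset N) → count (λ i → suc i ∈? (x ∷ S)) ≡ count (_∈? S)
  count-∈-∷ x S = count-cong (λ i → suc i ∈? (x ∷ S)) (_∈? S) (λ { i (there p) → p }) (λ i → there)

  ∣∣≡count : ∀ {N} (S : Subset N) → ∣ S ∣ ≡ count (_∈? S)
  ∣∣≡count []            = refl
  ∣∣≡count (inside ∷ S)  = cong suc (trans (∣∣≡count S) (sym (count-∈-∷ inside S)))
  ∣∣≡count (outside ∷ S) = trans (∣∣≡count S) (sym (count-∈-∷ outside S))

  subset : ∀ {N} {P : Pred (Fin N) 0ℓ} → Decidable P → Subset N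
  subset {zero}  P? = []
  subset {suc N} P? with P? zero
  ... | yes _ = inside  ∷ subset (P? ∘ suc)
  ... | no  _ = outside ∷ subset (P? ∘ suc)

  ∈-subset⁻ : ∀ {N} {P : Pred (Fin N) 0ℓ} (P? : Decidable P) i → i ∈ subset P? → P i
  ∈-subset⁻ {suc N} P? i i∈ with P? zero
  ∈-subset⁻ {suc N} P? zero    here       | yes p = p
  ∈-subset⁻ {suc N} P? (suc i) (there i∈) | yes _ = ∈-subset⁻ (P? ∘ suc) i i∈
  ∈-subset⁻ {suc N} P? (suc i) (there i∈) | no  _ = ∈-subset⁻ (P? ∘ suc) i i∈

  ∈-subset⁺ : ∀ {N} {P : Pred (Fin N) 0ℓ} (P? : Decidable P) i → P i → i ∈ subset P?
  ∈-subset⁺ {suc N} P? i p with P? zero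
  ∈-subset⁺ {suc N} P? zero    p | yes _  = here
  ∈-subset⁺ {suc N} P? zero    p | no  ¬p = contradiction p ¬p
  ∈-subset⁺ {suc N} P? (suc i) p | yes _  = there (∈-subset⁺ (P? ∘ suc) i p)
  ∈-subset⁺ {suc N} P? (suc i) p | no  _  = there (∈-subset⁺ (P? ∘ suc) i p)

  take : ∀ {N} {P : Pred (Fin N) 0ℓ} → Decidable P → ℕ → Subset N
  take {zero}  P? t = []
  take {suc N} P? t with P? zero | t
  ... | yes _ | suc t′ = inside  ∷ take (P? ∘ suc) t′
  ... | yes _ | zero   = outside ∷ take (P? ∘ suc) zero
  ... | no  _ | t′     = outside ∷ take (P? ∘ suc) t′

  take⊆ : ∀ {N} {P : Pred (Fin N) 0ℓ} (P? : Decidable P) t i → i ∈ take P? t → P i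
  take⊆ {suc N} P? t i i∈ with P? zero | t
  take⊆ {suc N} P? t zero    here       | yes p | suc t′ = p
  take⊆ {suc N} P? t (suc i) (there i∈) | yes _ | suc t′ = take⊆ (P? ∘ suc) t′ i i∈
  take⊆ {suc N} P? t (suc i) (there i∈) | yes _ | zero   = take⊆ (P? ∘ suc) zero i i∈
  take⊆ {suc N} P? t (suc i) (there i∈) | no  _ | t′     = take⊆ (P? ∘ suc) t′ i i∈

  count-take : ∀ {N} {P : Pred (Fin N) 0ℓ} (P? : Decidable P) t → t ≤ count P? → count (_∈? take P? t) ≡ t
  count-take {zero}  P? zero t≤ = refl
  count-take {suc N} P? t t≤ with P? zero | t
  ... | yes _ | suc t′ =
    cong suc (trans (count-∈-∷ inside (take (P? ∘ suc) t′)) (count-take (P? ∘ suc) t′ (≤-pred t≤)))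
  ... | yes _ | zero   = trans (count-∈-∷ outside (take (P? ∘ suc) zero)) (count-take (P? ∘ suc) zero z≤n)
  ... | no  _ | t′     = trans (count-∈-∷ outside (take (P? ∘ suc) t′)) (count-take (P? ∘ suc) t′ t≤)

  count-∩-comm : ∀ {N} {P Q : Pred (Fin N) 0ℓ} (P? : Decidable P) (Q? : Decidable Q) →
                 count (P? ∩? Q?) ≡ count (Q? ∩? P?)
  count-∩-comm P? Q? = count-cong (P? ∩? Q?) (Q? ∩? P?) (λ _ (p , q) → q , p) (λ _ (q , p) → p , q)

  take-missing : ∀ {N} {P : Pred (Fin N) 0ℓ} (P? : Decidable P) {t} → t ≤ count P? →
                 ∀ v → P v → v ∉ take P? t → suc t ≤ count P?
  take-missing P? {t} t≤ v p v∉ = begin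
    suc t                                  ≡⟨ cong suc (sym (count-take P? t t≤)) ⟩
    suc (count (_∈? T))                    ≡⟨ cong suc (count-cong (_∈? T) (P? ∩? (_∈? T))
                                                 (λ i i∈ → take⊆ P? t i i∈ , i∈) (λ i → proj₂)) ⟩
    suc (count (P? ∩? (_∈? T)))            ≡⟨ +-comm 1 _ ⟩
    count (P? ∩? (_∈? T)) + 1              ≤⟨ +-monoʳ-≤ _ (∃⇒1≤count (P? ∩? ∁? (_∈? T)) v (p , v∉)) ⟩
    count (P? ∩? (_∈? T)) + count (P? ∩? ∁? (_∈? T)) ≡⟨ sym (count-split P? (_∈? T)) ⟩
    count P?                               ∎
    where
    open ≤-Reasoning
    T = take P? t

module Arithmetic where

  open import Data.Nat
  open import Data.Nat.Properties
  open import Data.Nat.DivMod using (_/_; _%_; m≡m%n+[m/n]*n; m%n<n; m/n*n≤m; m/n<m; +-distrib-/)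
  open import Data.Nat.Solver using (module +-*-Solver)
  open import Relation.Nullary using (yes; no; contradiction)
  open import Relation.Binary.PropositionalEquality
  open +-*-Solver using (solve; _:+_; _:*_; _:=_; con)
  open ≤-Reasoning

  n≤1+2[n/2] : ∀ n → n ≤ suc (n / 2 + n / 2)
  n≤1+2[n/2] n = begin
    n                     ≡⟨ m≡m%n+[m/n]*n n 2 ⟩
    n % 2 + n / 2 * 2     ≤⟨ +-monoˡ-≤ _ (≤-pred (m%n<n n 2)) ⟩
    suc (n / 2 * 2)       ≡⟨ cong suc (*-comm (n / 2) 2) ⟩
    suc (n / 2 + (n / 2 + 0)) ≡⟨ cong (λ k → suc (n / 2 + k)) (+-identityʳ (n / 2)) ⟩
    suc (n / 2 + n / 2)   ∎

  2[n/2]≤n : ∀ n → n / 2 + n / 2 ≤ n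
  2[n/2]≤n n = begin
    n / 2 + n / 2         ≡⟨ cong ((n / 2) +_) (sym (+-identityʳ (n / 2))) ⟩
    2 * (n / 2)           ≡⟨ *-comm 2 (n / 2) ⟩
    n / 2 * 2             ≤⟨ m/n*n≤m n 2 ⟩
    n                     ∎

  [2+n]/2≡1+n/2 : ∀ n → (2 + n) / 2 ≡ suc (n / 2)
  [2+n]/2≡1+n/2 n = +-distrib-/ 2 n (m%n<n n 2)

  ≤1+2b⇒/2≤b : ∀ {x} b → x ≤ suc (b + b) → x / 2 ≤ b
  ≤1+2b⇒/2≤b {x} b x≤ with x / 2 ≤? b
  ... | yes x/2≤b = x/2≤b
  ... | no  x/2≰b = contradiction (begin-strict
        suc (b + b)           <⟨ s≤s (≤-reflexive (sym (+-suc b b))) ⟩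
        suc b + suc b         ≤⟨ +-mono-≤ b<x/2 b<x/2 ⟩
        x / 2 + x / 2         ≤⟨ 2[n/2]≤n x ⟩
        x                     ∎) (≤⇒≯ x≤)
    where b<x/2 = ≰⇒> x/2≰b

  <2a⇒1+[n/2]≤a : ∀ {n a} → suc n ≤ a + a → suc (n / 2) ≤ a
  <2a⇒1+[n/2]≤a {n} {suc a} n<2a =
    s≤s (≤1+2b⇒/2≤b a (≤-trans (≤-pred n<2a) (≤-reflexive (+-suc a a))))

  [u+2∸z]/2≤b : ∀ {u z b c} → c ≤ z → suc (u + z) ≤ (b + c) + (b + c) → (u + 2 ∸ z) / 2 ≤ b
  [u+2∸z]/2≤b {u} {z} {b} {c} c≤z h =
    ≤1+2b⇒/2≤b b (m≤n+o⇒m∸n≤o (u + 2) z (+-cancelʳ-≤ z (u + 2) (z + suc (b + b)) (begin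
      u + 2 + z                ≡⟨ solve 2 (λ u z → u :+ con 2 :+ z := con 2 :+ (u :+ z)) refl u z ⟩
      suc (suc (u + z))        ≤⟨ s≤s h ⟩
      suc ((b + c) + (b + c))  ≤⟨ s≤s (+-mono-≤ b+c≤b+z b+c≤b+z) ⟩
      suc ((b + z) + (b + z))  ≡⟨ solve 2 (λ b z → con 1 :+ ((b :+ z) :+ (b :+ z))
                                                 := z :+ (con 1 :+ (b :+ b)) :+ z) refl b z ⟩
      z + suc (b + b) + z      ∎)))
    where b+c≤b+z = +-monoʳ-≤ b c≤z

  m+n≤m*n : ∀ {m n} → 2 ≤ m → 2 ≤ n → m + n ≤ m * n
  m+n≤m*n {suc (suc m)} {suc (suc n)} (s≤s (s≤s _)) (s≤s (s≤s _)) = begin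
    2 + m + (2 + n)                  ≤⟨ m≤m+n _ (m + n + m * n) ⟩
    2 + m + (2 + n) + (m + n + m * n) ≡⟨ solve 2 (λ m n → con 2 :+ m :+ (con 2 :+ n) :+ (m :+ n :+ m :* n)
                                                     := (con 2 :+ m) :* (con 2 :+ n)) refl m n ⟩
    (2 + m) * (2 + n)                ∎

  1+n+z+nz≤2[a+x]⇒z<x : ∀ {n z a x} → 2 ≤ n → 2 ≤ z → a ≤ n →
          suc (n + (z + n * z)) ≤ (a + x) + (a + x) → suc z ≤ x
  1+n+z+nz≤2[a+x]⇒z<x {n} {z} {a} {x} 2≤n 2≤z a≤n h with suc z ≤? x
  ... | yes z<x = z<x
  ... | no  z≮x = contradiction (begin
        (a + x) + (a + x)   ≤⟨ +-mono-≤ a+x≤n+z a+x≤n+z ⟩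
        (n + z) + (n + z)   ≤⟨ +-monoʳ-≤ (n + z) (m+n≤m*n 2≤n 2≤z) ⟩
        (n + z) + n * z     ≡⟨ +-assoc n z (n * z) ⟩
        n + (z + n * z)     ∎) (<⇒≱ h)
    where a+x≤n+z = +-mono-≤ a≤n (≤-pred (≰⇒> z≮x))

  1+[n/2]≤n : ∀ {n} → 2 ≤ n → suc (n / 2) ≤ n
  1+[n/2]≤n {suc n} 2≤n = m/n<m (suc n) 2 (s≤s (s≤s z≤n))

  [u+2∸z]/2≤u : ∀ {u} z → 1 ≤ u → (u + 2 ∸ z) / 2 ≤ u
  [u+2∸z]/2≤u {u} z 1≤u = ≤1+2b⇒/2≤b u (begin
    u + 2 ∸ z     ≤⟨ m∸n≤m (u + 2) z ⟩
    u + 2         ≡⟨ +-suc u 1 ⟩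
    suc (u + 1)   ≤⟨ s≤s (+-monoʳ-≤ u 1≤u) ⟩
    suc (u + u)   ∎)

  1+u+z≤2[[u+2∸z]/2+z] : ∀ u z → let g = (u + 2 ∸ z) / 2 in suc (u + z) ≤ (g + z) + (g + z)
  1+u+z≤2[[u+2∸z]/2+z] u z = ≤-pred (begin
    suc (suc (u + z))   ≡⟨ solve 2 (λ u z → con 2 :+ (u :+ z) := u :+ con 2 :+ z) refl u z ⟩
    u + 2 + z           ≤⟨ +-monoˡ-≤ z (m≤n+m∸n (u + 2) z) ⟩
    z + w + z           ≤⟨ +-monoˡ-≤ z (+-monoʳ-≤ z (n≤1+2[n/2] w)) ⟩
    z + suc (g + g) + z ≡⟨ solve 2 (λ g z → z :+ (con 1 :+ (g :+ g)) :+ z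
                                         := con 1 :+ ((g :+ z) :+ (g :+ z))) refl g z ⟩
    suc ((g + z) + (g + z)) ∎)
    where
    w = u + 2 ∸ z
    g = w / 2

  1+n≤2[1+n/2] : ∀ n → suc n ≤ suc (n / 2) + suc (n / 2)
  1+n≤2[1+n/2] n = s≤s (≤-trans (n≤1+2[n/2] n) (≤-reflexive (sym (+-suc (n / 2) (n / 2)))))

module IntegerArithmetic where

  open import Function using (_∘_)
  open import Data.Nat using (zero; suc; _+_; _∸_; _≤_)
  open import Data.Nat.Properties using (+-comm; m+[n∸m]≡n)
  open import Data.Nat.DivMod using (_/_)
  open import Data.Integer as ℤ using (_⊖_; _/ℕ_)
  open import Data.Integer.Properties using ([+m]-[+n]≡m⊖n; +-cancelˡ-⊖)
  open import Relation.Binary.PropositionalEquality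
  open Arithmetic using ([2+n]/2≡1+n/2)
  open ≡-Reasoning

  -- _/ℕ_ rounds towards −∞, so this also holds for w < 2, where w ⊖ 2 is negative.
  2+[w⊖2]/2≡1+w/2 : ∀ w → ℤ.+ 2 ℤ.+ ((w ⊖ 2) /ℕ 2) ≡ ℤ.+ suc (w / 2)
  2+[w⊖2]/2≡1+w/2 zero          = refl
  2+[w⊖2]/2≡1+w/2 (suc zero)    = refl
  2+[w⊖2]/2≡1+w/2 (suc (suc w)) = cong (ℤ.+_ ∘ suc) (sym ([2+n]/2≡1+n/2 w))

  u-z≡[u+2∸z]⊖2 : ∀ {u z} → z ≤ u + 2 → ℤ.+ u ℤ.- ℤ.+ z ≡ (u + 2 ∸ z) ⊖ 2
  u-z≡[u+2∸z]⊖2 {u} {z} z≤u+2 = begin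
    ℤ.+ u ℤ.- ℤ.+ z                 ≡⟨ [+m]-[+n]≡m⊖n u z ⟩
    u ⊖ z                           ≡⟨ sym (+-cancelˡ-⊖ 2 u z) ⟩
    (2 + u) ⊖ (2 + z)               ≡⟨ cong₂ _⊖_ (trans (+-comm 2 u) (sym (m+[n∸m]≡n z≤u+2))) (+-comm 2 z) ⟩
    (z + (u + 2 ∸ z)) ⊖ (z + 2)     ≡⟨ +-cancelˡ-⊖ z (u + 2 ∸ z) 2 ⟩
    (u + 2 ∸ z) ⊖ 2                 ∎

module RingFacts (R : FinCommRing) where

  open import Level using (0ℓ)
  open import Data.Nat as ℕ using (suc; _≤_)
  open import Data.Nat.Properties using (≤-trans; ≤-reflexive; 1+n≰n)
  open import Data.Fin using (Fin)
  open import Data.Fin.Properties using (_≟_; any?)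
  open import Data.Product using (_,_; proj₂)
  open import Data.Sum using (_⊎_; inj₁; inj₂)
  open import Data.Unit using (tt)
  open import Function using (_∘_)
  open import Relation.Nullary using (¬_; yes; no; contradiction)
  open import Relation.Unary using (Pred; Decidable)
  open import Relation.Unary.Properties using (U?; _∩?_; ∁?)
  open import Relation.Binary.PropositionalEquality as ≡ using (_≡_)
  import Algebra.Properties.Ring as RingProperties
  open Counting

  open FinCommRing R
  open RingProperties ring using (x[y-z]≈xy-xz; -0#≈0#; +-cancelˡ; x∙y⁻¹≈ε⇒x≈y; x≈y⇒x∙y⁻¹≈ε)
  open import Relation.Binary.Reasoning.Setoid setoid

  elem-injective : ∀ i j → elem i ≈ elem j → i ≡ j
  elem-injective i j e = ≡.trans (≡.sym (index-elem i)) (≡.trans (index-cong e) (index-elem j))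

  index-injective : ∀ x y → index x ≡ index y → x ≈ y
  index-injective x y e = trans (sym (elem-index x)) (trans (reflexive (≡.cong elem e)) (elem-index y))

  x≈0⇒x*y≈0 : ∀ {x y} → x ≈ 0# → x * y ≈ 0#
  x≈0⇒x*y≈0 x≈0 = trans (*-cong x≈0 refl) (zeroˡ _)

  y≈0⇒x*y≈0 : ∀ {x y} → y ≈ 0# → x * y ≈ 0#
  y≈0⇒x*y≈0 y≈0 = trans (*-cong refl y≈0) (zeroʳ _)

  IsZD*-resp : ∀ {x y} → x ≈ y → IsZD* x → IsZD* y
  IsZD*-resp x≈y (x≉0 , w , w≉0 , xw≈0) = x≉0 ∘ trans x≈y , w , w≉0 , trans (*-cong (sym x≈y) refl) xw≈0

  IsUnit-resp : ∀ {x y} → x ≈ y → IsUnit x → IsUnit y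
  IsUnit-resp x≈y (w , xw≈1) = w , trans (*-cong (sym x≈y) refl) xw≈1

  ZD*-partner : ∀ {x y} → ¬ x ≈ 0# → ¬ y ≈ 0# → x * y ≈ 0# → IsZD* y
  ZD*-partner {x} {y} x≉0 y≉0 xy≈0 = y≉0 , x , x≉0 , trans (*-comm y x) xy≈0

  unit⇒≉0 : ∀ {x} → IsUnit x → ¬ x ≈ 0#
  unit⇒≉0 (w , xw≈1) x≈0 = 1≉0 (trans (sym xw≈1) (x≈0⇒x*y≈0 x≈0))

  unit-cancelˡ : ∀ {x y} → IsUnit x → x * y ≈ 0# → y ≈ 0#
  unit-cancelˡ {x} {y} (w , xw≈1) xy≈0 = begin
    y            ≈⟨ sym (*-identityˡ y) ⟩
    1# * y       ≈⟨ *-cong (trans (sym xw≈1) (*-comm x w)) refl ⟩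
    (w * x) * y  ≈⟨ *-assoc w x y ⟩
    w * (x * y)  ≈⟨ y≈0⇒x*y≈0 xy≈0 ⟩
    0#           ∎

  unit-cancelʳ : ∀ {x y} → IsUnit y → x * y ≈ 0# → x ≈ 0#
  unit-cancelʳ u xy≈0 = unit-cancelˡ u (trans (*-comm _ _) xy≈0)

  unit⇒¬ZD* : ∀ {x} → IsUnit x → ¬ IsZD* x
  unit⇒¬ZD* u (_ , y , y≉0 , xy≈0) = y≉0 (unit-cancelˡ u xy≈0)

  ¬ZD*-cancelˡ : ∀ {x y z} → ¬ x ≈ 0# → ¬ IsZD* x → x * y ≈ x * z → y ≈ z
  ¬ZD*-cancelˡ {x} {y} {z} x≉0 ¬zd xy≈xz with (y - z) ≈? 0#
  ... | yes y-z≈0 = x∙y⁻¹≈ε⇒x≈y y z y-z≈0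
  ... | no  y-z≉0 = contradiction (x≉0 , y - z , y-z≉0 , trans (x[y-z]≈xy-xz x y z) (x≈y⇒x∙y⁻¹≈ε xy≈xz)) ¬zd

  -- In a finite ring, multiplication by a non-zero-divisor is injective, hence surjective: it hits 1.
  ¬ZD*⇒unit : ∀ {x} → ¬ x ≈ 0# → ¬ IsZD* x → IsUnit x
  ¬ZD*⇒unit {x} x≉0 ¬zd with any? (λ i → index (x * elem i) ≟ index 1#)
  ... | yes (i , hit) = elem i , index-injective _ _ hit
  ... | no  misses    = contradiction (≤-trans (≤-reflexive (≡.sym (count-remove all? t tt))) pigeonhole) (1+n≰n)
    where
    all? = U? {A = Fin size}
    t = index 1#
    pigeonhole = count-injective all? (all? ∩? ∁? (_≟ t)) (λ i → index (x * elem i))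
      (λ i j _ _ e → elem-injective i j (¬ZD*-cancelˡ x≉0 ¬zd (index-injective _ _ e)))
      (λ i _ → tt , λ hit → misses (i , hit))

  nonzero⇒unit⊎ZD* : ∀ x → ¬ x ≈ 0# → IsUnit x ⊎ IsZD* x
  nonzero⇒unit⊎ZD* x x≉0 with isZD*? x
  ... | yes zd = inj₂ zd
  ... | no ¬zd = inj₁ (¬ZD*⇒unit x≉0 ¬zd)

  1+nilpotent-unit : ∀ x → x * x ≈ 0# → IsUnit (1# + x)
  1+nilpotent-unit x x²≈0 = 1# - x , (begin
    (1# + x) * (1# - x)            ≈⟨ distribʳ (1# - x) 1# x ⟩
    1# * (1# - x) + x * (1# - x)   ≈⟨ +-cong (*-identityˡ _) (x[y-z]≈xy-xz x 1# x) ⟩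
    (1# - x) + (x * 1# - x * x)    ≈⟨ +-cong refl (+-cong (*-identityʳ x) (trans (-‿cong x²≈0) -0#≈0#)) ⟩
    (1# - x) + (x + 0#)            ≈⟨ +-cong refl (+-identityʳ x) ⟩
    (1# - x) + x                   ≈⟨ +-assoc 1# (- x) x ⟩
    1# + (- x + x)                 ≈⟨ +-cong refl (-‿inverseˡ x) ⟩
    1# + 0#                        ≈⟨ +-identityʳ 1# ⟩
    1#                             ∎)

  Zero Unit ZD* : Pred (Fin size) 0ℓ
  Zero i = elem i ≈ 0#
  Unit i = IsUnit (elem i)
  ZD*  i = IsZD* (elem i)

  Zero? : Decidable Zero
  Zero? i = elem i ≈? 0#

  Unit? : Decidable Unit
  Unit? i = isUnit? (elem i)

  ZD*? : Decidable ZD*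
  ZD*? i = isZD*? (elem i)

  count-Zero : count Zero? ≡ 1
  count-Zero = count-unique Zero? (index 0#) (elem-index 0#)
    (λ i i≈0 → elem-injective i (index 0#) (trans i≈0 (sym (elem-index 0#))))

  |Z*|≡count : |Z*| ≡ count ZD*?
  |Z*|≡count = length-filter-allFin ZD*?

  |U|≡count : |U| ≡ count Unit?
  |U|≡count = length-filter-allFin Unit?

  |nonzero|≡count : |nonzero| ≡ count (∁? Zero?)
  |nonzero|≡count = length-filter-allFin (∁? Zero?)

  size≡1+|nonzero| : size ≡ suc |nonzero|
  size≡1+|nonzero| = ≡.trans (≡.sym (count-all all? (λ _ → tt)))
    (≡.trans (count-split all? Zero?) (≡.cong₂ ℕ._+_ zeros nonzeros))
    where
    all? = U? {A = Fin size}
    zeros : count (all? ∩? Zero?) ≡ 1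
    zeros = ≡.trans (count-cong _ Zero? (λ _ → proj₂) (λ _ → tt ,_)) count-Zero
    nonzeros : count (all? ∩? ∁? Zero?) ≡ |nonzero|
    nonzeros = ≡.trans (count-cong _ (∁? Zero?) (λ _ → proj₂) (λ _ → tt ,_)) (≡.sym |nonzero|≡count)

  1≤|U| : 1 ≤ |U|
  1≤|U| = ≤-trans (∃⇒1≤count Unit? (index 1#) (IsUnit-resp (sym (elem-index 1#)) (1# , *-identityˡ 1#)))
                  (≤-reflexive (≡.sym |U|≡count))

module Complete (R : FinCommRing) (complete : FinCommRing.ΓComplete R) where

  open import Data.Nat as ℕ using (_≤_; z≤n; s≤s; _≤?_)
  open import Data.Nat.Properties using (≤-trans; ≤-reflexive; ≤-pred; m≤m+n; m≤n+m; ≰⇒>)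
  open import Data.Fin.Properties using (_≟_)
  open import Data.Product using (_,_; proj₁)
  open import Relation.Nullary using (¬_; yes; no)
  open import Relation.Unary.Properties using (_∩?_; ∁?)
  open import Relation.Binary.PropositionalEquality as ≡ using (_≡_)
  import Algebra.Properties.Ring as RingProperties
  open Counting
  open RingFacts R

  open FinCommRing R
  open RingProperties ring using (+-cancelˡ)
  open import Relation.Binary.Reasoning.Setoid setoid

  square≈0 : ∀ {x y w} → IsZD* x → IsZD* y → IsZD* w → ¬ x ≈ y → ¬ x ≈ w → ¬ y ≈ w → x * x ≈ 0#
  square≈0 {x} {y} {w} zx zy zw x≉y x≉w y≉w = begin
    x * x            ≈⟨ sym (+-identityʳ _) ⟩
    x * x + 0#       ≈⟨ +-cong refl (sym xy≈0) ⟩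
    x * x + x * y    ≈⟨ sym (distribˡ x x y) ⟩
    x * (x + y)      ≈⟨ x[x+y]≈0 ⟩
    0#               ∎
    where
    xy≈0 = complete x y zx zy x≉y
    -- x + y is either 0 or a zero-divisor (it kills w) different from x
    x[x+y]≈0 : x * (x + y) ≈ 0#
    x[x+y]≈0 with (x + y) ≈? 0#
    ... | yes x+y≈0 = y≈0⇒x*y≈0 x+y≈0
    ... | no  x+y≉0 = complete x (x + y) zx (x+y≉0 , w , proj₁ zw , [x+y]w≈0) x≉x+y
      where
      [x+y]w≈0 : (x + y) * w ≈ 0#
      [x+y]w≈0 = trans (distribʳ w x y)
                   (trans (+-cong (complete x w zx zw x≉w) (complete y w zy zw y≉w)) (+-identityʳ 0#))
      x≉x+y : ¬ x ≈ x + y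
      x≉x+y x≈x+y = proj₁ zy (+-cancelˡ x y 0# (trans (sym x≈x+y) (sym (+-identityʳ x))))

  ZD*-square≈0 : 3 ≤ |Z*| → ∀ j → ZD* j → elem j * elem j ≈ 0#
  ZD*-square≈0 3≤z j zj =
    let others = ZD*? ∩? ∁? (_≟ j)
        2≤others : 2 ≤ count others
        2≤others = ≤-pred (≤-trans 3≤z (≤-reflexive (≡.trans |Z*|≡count (count-remove ZD*? j zj))))
        (k , zk , k≢j) = 1≤count⇒∃ others (≤-trans (s≤s z≤n) 2≤others)
        ((l , (zl , l≢j) , l≢k)) = 1≤count⇒∃ (others ∩? ∁? (_≟ k))
          (≤-pred (≤-trans 2≤others (≤-reflexive (count-remove others k (zk , k≢j)))))
        distinct : ∀ {i i′} → ¬ i′ ≡ i → ¬ elem i ≈ elem i′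
        distinct i′≢i e = i′≢i (≡.sym (elem-injective _ _ e))
    in square≈0 zj zk zl (distinct k≢j) (distinct l≢j) (distinct l≢k)

  |Z*|≤|U| : 3 ≤ |Z*| → |Z*| ≤ |U|
  |Z*|≤|U| 3≤z = ≤-trans (≤-reflexive |Z*|≡count) (≤-trans
    (count-injective ZD*? Unit? (λ i → index (1# + elem i))
      (λ i j _ _ e → elem-injective i j (+-cancelˡ 1# _ _ (index-injective _ _ e)))
      (λ i zi → IsUnit-resp (sym (elem-index _)) (1+nilpotent-unit (elem i) (ZD*-square≈0 3≤z i zi))))
    (≤-reflexive (≡.sym |U|≡count)))

  |Z*|≤|U|+2 : |Z*| ≤ |U| ℕ.+ 2
  |Z*|≤|U|+2 with 3 ≤? |Z*|
  ... | yes 3≤z = ≤-trans (|Z*|≤|U| 3≤z) (m≤m+n |U| 2)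
  ... | no  3≰z = ≤-trans (≤-pred (≰⇒> 3≰z)) (m≤n+m 2 |U|)

module Alliance (G : FinCommRing) where

  open import Level using (0ℓ)
  open import Data.Nat as ℕ using (ℕ; zero; suc; _≤_; z≤n; s≤s)
  open import Data.Nat.Properties using (≤-trans; ≤-reflexive; +-suc; +-identityʳ; +-comm; +-monoʳ-≤; +-cancelˡ-≤)
  open import Data.Fin using (Fin)
  open import Data.Fin.Subset using (Subset; _∈_; _∉_)
  open import Data.Fin.Subset.Properties using (_∈?_)
  open import Data.Product using (∃; _×_; _,_; proj₁)
  open import Data.Sum using (_⊎_; inj₁; inj₂)
  open import Relation.Nullary using (¬_)
  open import Relation.Unary using (Pred; Decidable)
  open import Relation.Unary.Properties using (_∩?_; _∪?_; ∁?)
  open import Relation.Binary.PropositionalEquality as ≡ using (_≡_; refl)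
  open Counting
  open RingFacts G

  private module G = FinCommRing G
  open G using (size; Vertex; Adj; adj?; δ; δ̄; elem; index; elem-index)

  degree : Fin size → ℕ
  degree v = count (adj? v)

  vertex-neighbour : ∀ v → Vertex v → ¬ elem v G.* elem v G.≈ G.0# → ∃ (Adj v)
  vertex-neighbour v vv@(v≉0 , p , p≉0 , vp≈0) v²≉0 =
    index p , vv , IsZD*-resp (G.sym (elem-index p)) (ZD*-partner v≉0 p≉0 vp≈0) , v≢p ,
    G.trans (G.*-cong G.refl (elem-index p)) vp≈0
    where
    v≢p : ¬ v ≡ index p
    v≢p refl = v²≉0 (G.trans (G.*-cong G.refl (elem-index p)) vp≈0)

  ∣_∩_∣ : ∀ {Q : Pred (Fin size) 0ℓ} → Decidable Q → Subset size → ℕ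
  ∣ Q? ∩ S ∣ = count (Q? ∩? (_∈? S))

  module _ {S : Subset size} where

    δ≡∣adj∩∣ : ∀ v → δ S v ≡ ∣ adj? v ∩ S ∣
    δ≡∣adj∩∣ v = ≡.trans (length-filter-allFin ((_∈? S) ∩? adj? v)) (count-∩-comm (_∈? S) (adj? v))

    δ̄≡count : ∀ v → δ̄ S v ≡ count (adj? v ∩? ∁? (_∈? S))
    δ̄≡count v = ≡.trans (length-filter-allFin (∁? (_∈? S) ∩? adj? v)) (count-∩-comm (∁? (_∈? S)) (adj? v))

    degree≡δ+δ̄ : ∀ v → degree v ≡ δ S v ℕ.+ δ̄ S v
    degree≡δ+δ̄ v = ≡.trans (count-split (adj? v) (_∈? S))
      (≡.sym (≡.cong₂ ℕ._+_ (δ≡∣adj∩∣ v) (δ̄≡count v)))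

    offensive⇒2δ>degree : ∀ v → suc (δ̄ S v) ≤ δ S v → suc (degree v) ≤ δ S v ℕ.+ δ S v
    offensive⇒2δ>degree v off = ≤-trans (≤-reflexive (≡.trans (≡.cong suc (degree≡δ+δ̄ v)) (≡.sym (+-suc _ _))))
                                        (+-monoʳ-≤ (δ S v) off)

    2δ>degree⇒offensive : ∀ v → suc (degree v) ≤ δ S v ℕ.+ δ S v → suc (δ̄ S v) ≤ δ S v
    2δ>degree⇒offensive v 2δ> = +-cancelˡ-≤ (δ S v) _ _
      (≤-trans (≤-reflexive (≡.trans (+-suc _ _) (≡.cong suc (≡.sym (degree≡δ+δ̄ v))))) 2δ>)

    count≤δ : ∀ {Q : Pred (Fin size) 0ℓ} (Q? : Decidable Q) v → (∀ l → Q l → Adj v l × l ∈ S) → count Q? ≤ δ S v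
    count≤δ Q? v Q⊆N∩S = ≤-trans (count-mono Q? (adj? v ∩? (_∈? S)) Q⊆N∩S) (≤-reflexive (≡.sym (δ≡∣adj∩∣ v)))

    δ̄≡0 : ∀ v → (∀ l → Adj v l → l ∈ S) → δ̄ S v ≡ 0
    δ̄≡0 v N⊆S = ≡.trans (δ̄≡count v) (count-none (adj? v ∩? ∁? (_∈? S)) λ l (adj , l∉S) → l∉S (N⊆S l adj))

    1≤δ : ∀ v l → Adj v l → l ∈ S → 1 ≤ δ S v
    1≤δ v l adj l∈S = ≤-trans (∃⇒1≤count (adj? v ∩? (_∈? S)) l (adj , l∈S)) (≤-reflexive (≡.sym (δ≡∣adj∩∣ v)))

    1≤δ̄ : ∀ v l → Adj v l → l ∉ S → 1 ≤ δ̄ S v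
    1≤δ̄ v l adj l∉S = ≤-trans (∃⇒1≤count (adj? v ∩? ∁? (_∈? S)) l (adj , l∉S)) (≤-reflexive (≡.sym (δ̄≡count v)))

    module _ {Q : Pred (Fin size) 0ℓ} (Q? : Decidable Q) where

      δ≤∣∩∣ : ∀ v → (∀ l → Adj v l → Q l) → δ S v ≤ ∣ Q? ∩ S ∣
      δ≤∣∩∣ v N⊆Q = ≤-trans (≤-reflexive (δ≡∣adj∩∣ v))
        (count-mono (adj? v ∩? (_∈? S)) (Q? ∩? (_∈? S)) λ l (adj , l∈S) → N⊆Q l adj , l∈S)

      ∣∩∣≤count : ∣ Q? ∩ S ∣ ≤ count Q?
      ∣∩∣≤count = count-mono (Q? ∩? (_∈? S)) Q? λ _ → proj₁

      missing⇒∣∩∣<count : ∀ v → Q v → v ∉ S → suc ∣ Q? ∩ S ∣ ≤ count Q?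
      missing⇒∣∩∣<count v q v∉S = ≤-trans
        (≤-trans (≤-reflexive (+-comm 1 _)) (+-monoʳ-≤ ∣ Q? ∩ S ∣ (∃⇒1≤count (Q? ∩? ∁? (_∈? S)) v (q , v∉S))))
        (≤-reflexive (≡.sym (count-split Q? (_∈? S))))

      ∣∩∣≡count⊎missing : (∣ Q? ∩ S ∣ ≡ count Q?) ⊎ ∃ λ v → Q v × v ∉ S
      ∣∩∣≡count⊎missing with count (Q? ∩? ∁? (_∈? S)) in missing
      ... | zero  = inj₁ (≡.sym (≡.trans (count-split Q? (_∈? S))
                            (≡.trans (≡.cong (∣ Q? ∩ S ∣ ℕ.+_) missing) (+-identityʳ _))))
      ... | suc _ = inj₂ (1≤count⇒∃ (Q? ∩? ∁? (_∈? S)) (≤-trans (s≤s z≤n) (≤-reflexive (≡.sym missing))))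

    ∣∪∩∣ : ∀ {P Q : Pred (Fin size) 0ℓ} (P? : Decidable P) (Q? : Decidable Q) → (∀ i → P i → ¬ Q i) →
           ∣ P? ∪? Q? ∩ S ∣ ≡ ∣ P? ∩ S ∣ ℕ.+ ∣ Q? ∩ S ∣
    ∣∪∩∣ {P} {Q} P? Q? disjoint =
      ≡.trans (count-cong ((P? ∪? Q?) ∩? (_∈? S)) (P? ∩? (_∈? S) ∪? Q? ∩? (_∈? S)) distrib factor)
              (count-∪ (P? ∩? (_∈? S)) (Q? ∩? (_∈? S)) λ i (p , _) (q , _) → disjoint i p q)
      where
      distrib : ∀ i → (P i ⊎ Q i) × i ∈ S → (P i × i ∈ S) ⊎ (Q i × i ∈ S)
      distrib i (inj₁ p , i∈S) = inj₁ (p , i∈S)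
      distrib i (inj₂ q , i∈S) = inj₂ (q , i∈S)
      factor : ∀ i → (P i × i ∈ S) ⊎ (Q i × i ∈ S) → (P i ⊎ Q i) × i ∈ S
      factor i (inj₁ (p , i∈S)) = inj₁ p , i∈S
      factor i (inj₂ (q , i∈S)) = inj₂ q , i∈S

module ProductGraph (F R : FinCommRing) (F-field : IsField F) (3≤|F| : 3 ≤ FinCommRing.size F)
                    (complete : FinCommRing.ΓComplete R) where

  open import Level using (0ℓ)
  open import Function using (_∘_)
  open import Data.Nat as ℕ using (ℕ; suc; _+_; _*_; _∸_; _⊓_; _≤_; _<_; _≤?_; z≤n; s≤s; >-nonZero)
  open import Data.Nat.DivMod using (_/_)
  open import Data.Nat.Properties
    using (*-identityʳ; +-identityʳ; +-comm; ≤-trans; ≤-reflexive; ≤-pred; ≰⇒>; +-mono-≤; *-mono-≤;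
           m≤m+n; m≤n+m; m≤n*m; <-irrefl; ≤-refl; m<m+n; ⊓-sel; m⊓n≤m; m⊓n≤n; module ≤-Reasoning)
  open import Data.Fin using (Fin; quotient; remainder)
  open import Data.Fin.Properties using (_≟_)
  open import Data.Fin.Subset using (Subset; _∈_; _∉_; ∣_∣)
  open import Data.Fin.Subset.Properties using (_∈?_)
  open import Data.Product using (∃; _×_; _,_; proj₁; proj₂)
  open import Data.Sum using (_⊎_; inj₁; inj₂)
  open import Data.Unit using (tt)
  open import Relation.Nullary using (¬_; yes; no; contradiction)
  open import Relation.Nullary.Decidable using (_×-dec_)
  open import Relation.Unary using (Pred; Decidable; _∪_; ∁; U)
  open import Relation.Unary.Properties using (_∩?_; _∪?_; ∁?; U?)
  open import Relation.Binary.PropositionalEquality as ≡ using (_≡_; refl)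
  open Counting

  module F = FinCommRing F
  module R = FinCommRing R
  module F′ = RingFacts F
  module R′ = RingFacts R
  open FinCommRing (F ×R R) using (size; Vertex; Adj; adj?; δ; δ̄; IsGOA)
  open Alliance (F ×R R)
  open Arithmetic
  open IntegerArithmetic
  import Data.Integer as ℤ
  open Complete R complete using (|Z*|≤|U|+2)

  n u z : ℕ
  n = F.|nonzero|
  u = R.|U|
  z = R.|Z*|

  first : Fin size → Fin F.size
  first = quotient R.size

  second : Fin size → Fin R.size
  second = remainder {F.size} R.size

  _⊗_ : Pred (Fin F.size) 0ℓ → Pred (Fin R.size) 0ℓ → Pred (Fin size) 0ℓ
  (X ⊗ Y) k = X (first k) × Y (second k)

  _⊗?_ : ∀ {X Y} → Decidable X → Decidable Y → Decidable (X ⊗ Y)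
  (X? ⊗? Y?) k = X? (first k) ×-dec Y? (second k)

  count-⊗ : ∀ {X Y} (X? : Decidable X) (Y? : Decidable Y) → count (X? ⊗? Y?) ≡ count X? * count Y?
  count-⊗ = count-× F.size R.size

  F*×0 0×U 0×Z* F*×Z* : Pred (Fin size) 0ℓ
  F*×0  = ∁ F′.Zero ⊗ R′.Zero
  0×U   = F′.Zero   ⊗ R′.Unit
  0×Z*  = F′.Zero   ⊗ R′.ZD*
  F*×Z* = ∁ F′.Zero ⊗ R′.ZD*

  F*×0? : Decidable F*×0
  F*×0? = ∁? F′.Zero? ⊗? R′.Zero?

  0×U? : Decidable 0×U
  0×U? = F′.Zero? ⊗? R′.Unit?

  0×Z*? : Decidable 0×Z*
  0×Z*? = F′.Zero? ⊗? R′.ZD*?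

  F*×Z*? : Decidable F*×Z*
  F*×Z*? = ∁? F′.Zero? ⊗? R′.ZD*?

  count-F*×0 : count F*×0? ≡ n
  count-F*×0 = ≡.trans (count-⊗ (∁? F′.Zero?) R′.Zero?)
    (≡.trans (≡.cong₂ _*_ (≡.sym F′.|nonzero|≡count) R′.count-Zero) (*-identityʳ n))

  count-0×U : count 0×U? ≡ u
  count-0×U = ≡.trans (count-⊗ F′.Zero? R′.Unit?)
    (≡.trans (≡.cong₂ _*_ F′.count-Zero (≡.sym R′.|U|≡count)) (+-identityʳ u))

  count-0×Z* : count 0×Z*? ≡ z
  count-0×Z* = ≡.trans (count-⊗ F′.Zero? R′.ZD*?)
    (≡.trans (≡.cong₂ _*_ F′.count-Zero (≡.sym R′.|Z*|≡count)) (+-identityʳ z))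

  count-F*×Z* : count F*×Z*? ≡ n * z
  count-F*×Z* = ≡.trans (count-⊗ (∁? F′.Zero?) R′.ZD*?)
    (≡.cong₂ _*_ (≡.sym F′.|nonzero|≡count) (≡.sym R′.|Z*|≡count))

  OtherZD* : Fin size → Pred (Fin R.size) 0ℓ
  OtherZD* v j = R′.ZD* j × ¬ j ≡ second v

  OtherZD*? : ∀ v → Decidable (OtherZD* v)
  OtherZD*? v = R′.ZD*? ∩? ∁? (_≟ second v)

  F-cancel : ∀ {a c} → ¬ a F.≈ F.0# → a F.* c F.≈ F.0# → c F.≈ F.0#
  F-cancel a≉0 = F′.unit-cancelˡ (F-field _ a≉0)

  distinct-ZD*-product≈0 : ∀ {i j} → R′.ZD* i → R′.ZD* j → ¬ j ≡ i → R.elem i R.* R.elem j R.≈ R.0#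
  distinct-ZD*-product≈0 zi zj j≢i = complete _ _ zi zj λ e → j≢i (≡.sym (R′.elem-injective _ _ e))

  F*×0⊆Vertex : ∀ {k} → F*×0 k → Vertex k
  F*×0⊆Vertex (a≉0 , b≈0) =
    a≉0 ∘ proj₁ , (F.0# , R.1#) , R.1≉0 ∘ proj₂ , (F.zeroʳ _ , R′.x≈0⇒x*y≈0 b≈0)

  0×U⊆Vertex : ∀ {k} → 0×U k → Vertex k
  0×U⊆Vertex (a≈0 , unit) =
    R′.unit⇒≉0 unit ∘ proj₂ , (F.1# , R.0#) , F.1≉0 ∘ proj₁ , (F′.x≈0⇒x*y≈0 a≈0 , R.zeroʳ _)

  ZD*-second⇒Vertex : ∀ {k} → R′.ZD* (second k) → Vertex k
  ZD*-second⇒Vertex (b≉0 , w , w≉0 , bw≈0) = b≉0 ∘ proj₂ , (F.0# , w) , w≉0 ∘ proj₂ , (F.zeroʳ _ , bw≈0)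

  vertex-classes : ∀ k → Vertex k → (F*×0 ∪ 0×U ∪ 0×Z* ∪ F*×Z*) k
  vertex-classes k (k≉0 , _ , p≉0 , (ac≈0 , bd≈0)) with F′.Zero? (first k) | R′.Zero? (second k)
  ... | yes a≈0 | yes b≈0 = contradiction (a≈0 , b≈0) k≉0
  ... | no  a≉0 | yes b≈0 = inj₁ (a≉0 , b≈0)
  ... | yes a≈0 | no  b≉0 with R′.nonzero⇒unit⊎ZD* _ b≉0
  ...   | inj₁ unit = inj₂ (inj₁ (a≈0 , unit))
  ...   | inj₂ zd   = inj₂ (inj₂ (inj₁ (a≈0 , zd)))
  vertex-classes k (k≉0 , _ , p≉0 , (ac≈0 , bd≈0)) | no a≉0 | no b≉0 with R′.nonzero⇒unit⊎ZD* _ b≉0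
  ...   | inj₁ unit = contradiction (F-cancel a≉0 ac≈0 , R′.unit-cancelˡ unit bd≈0) p≉0
  ...   | inj₂ zd   = inj₂ (inj₂ (inj₂ (a≉0 , zd)))

  F*×0-neighbours : ∀ {v l} → F*×0 v → Adj v l → (0×U ∪ 0×Z*) l
  F*×0-neighbours (a≉0 , _) (_ , vl , _ , ac≈0 , _) with vertex-classes _ vl
  ... | inj₁ (c≉0 , _)               = contradiction (F-cancel a≉0 ac≈0) c≉0
  ... | inj₂ (inj₁ l∈0×U)            = inj₁ l∈0×U
  ... | inj₂ (inj₂ (inj₁ l∈0×Z*))    = inj₂ l∈0×Z*
  ... | inj₂ (inj₂ (inj₂ (c≉0 , _))) = contradiction (F-cancel a≉0 ac≈0) c≉0

  0×U-neighbours : ∀ {v l} → 0×U v → Adj v l → F*×0 l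
  0×U-neighbours (_ , unit) (_ , vl , _ , _ , bd≈0) with vertex-classes _ vl
  ... | inj₁ l∈F*×0                   = l∈F*×0
  ... | inj₂ (inj₁ (_ , unit′))        = contradiction (R′.unit-cancelˡ unit bd≈0) (R′.unit⇒≉0 unit′)
  ... | inj₂ (inj₂ (inj₁ (_ , zd)))    = contradiction (R′.unit-cancelˡ unit bd≈0) (proj₁ zd)
  ... | inj₂ (inj₂ (inj₂ (_ , zd)))    = contradiction (R′.unit-cancelˡ unit bd≈0) (proj₁ zd)

  0×Z*-neighbours : ∀ {v l} → 0×Z* v → Adj v l → (F*×0 ∪ 0×Z* ∪ F*×Z*) l
  0×Z*-neighbours (_ , zd) (_ , vl , _ , _ , bd≈0) with vertex-classes _ vl
  ... | inj₁ l∈F*×0             = inj₁ l∈F*×0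
  ... | inj₂ (inj₁ (_ , unit))  = contradiction (R′.unit-cancelʳ unit bd≈0) (proj₁ zd)
  ... | inj₂ (inj₂ l∈0×Z*∪F*×Z*) = inj₂ l∈0×Z*∪F*×Z*

  F*×Z*-neighbours : ∀ {v l} → F*×Z* v → Adj v l → 0×Z* l
  F*×Z*-neighbours (a≉0 , zd) (_ , vl , _ , ac≈0 , bd≈0) with vertex-classes _ vl
  ... | inj₁ (c≉0 , _)               = contradiction (F-cancel a≉0 ac≈0) c≉0
  ... | inj₂ (inj₁ (_ , unit))        = contradiction (R′.unit-cancelʳ unit bd≈0) (proj₁ zd)
  ... | inj₂ (inj₂ (inj₁ l∈0×Z*))    = l∈0×Z*
  ... | inj₂ (inj₂ (inj₂ (c≉0 , _))) = contradiction (F-cancel a≉0 ac≈0) c≉0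

  F*×0-adjacent : ∀ {v l} → F*×0 v → (0×U ∪ 0×Z*) l → Adj v l
  F*×0-adjacent (a≉0 , b≈0) (inj₁ l∈0×U@(c≈0 , _)) =
    F*×0⊆Vertex (a≉0 , b≈0) , 0×U⊆Vertex l∈0×U , (λ { refl → a≉0 c≈0 }) ,
    (F′.y≈0⇒x*y≈0 c≈0 , R′.x≈0⇒x*y≈0 b≈0)
  F*×0-adjacent (a≉0 , b≈0) (inj₂ (c≈0 , zd)) =
    F*×0⊆Vertex (a≉0 , b≈0) , ZD*-second⇒Vertex zd , (λ { refl → a≉0 c≈0 }) ,
    (F′.y≈0⇒x*y≈0 c≈0 , R′.x≈0⇒x*y≈0 b≈0)

  0×U-adjacent : ∀ {v l} → 0×U v → F*×0 l → Adj v l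
  0×U-adjacent (a≈0 , unit) (c≉0 , d≈0) =
    0×U⊆Vertex (a≈0 , unit) , F*×0⊆Vertex (c≉0 , d≈0) , (λ { refl → c≉0 a≈0 }) ,
    (F′.x≈0⇒x*y≈0 a≈0 , R′.y≈0⇒x*y≈0 d≈0)

  0×Z*-adjacent : ∀ {v l} → 0×Z* v → (F*×0 ∪ U ⊗ OtherZD* v) l → Adj v l
  0×Z*-adjacent (a≈0 , zd) (inj₁ (c≉0 , d≈0)) =
    ZD*-second⇒Vertex zd , F*×0⊆Vertex (c≉0 , d≈0) , (λ { refl → c≉0 a≈0 }) ,
    (F′.x≈0⇒x*y≈0 a≈0 , R′.y≈0⇒x*y≈0 d≈0)
  0×Z*-adjacent (a≈0 , zd) (inj₂ (_ , zd′ , l≢v)) =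
    ZD*-second⇒Vertex zd , ZD*-second⇒Vertex zd′ , (λ v≡l → l≢v (≡.cong second (≡.sym v≡l))) ,
    (F′.x≈0⇒x*y≈0 a≈0 , distinct-ZD*-product≈0 zd zd′ l≢v)

  F*×Z*-adjacent : ∀ {v l} → F*×Z* v → 0×Z* l → ¬ second l ≡ second v → Adj v l
  F*×Z*-adjacent (a≉0 , zd) (c≈0 , zd′) l≢v =
    ZD*-second⇒Vertex zd , ZD*-second⇒Vertex zd′ , (λ { refl → a≉0 c≈0 }) ,
    (F′.y≈0⇒x*y≈0 c≈0 , distinct-ZD*-product≈0 zd zd′ l≢v)

  z₁ : Fin size → ℕ
  z₁ v = count (OtherZD*? v)

  z≡1+z₁ : ∀ {v} → 0×Z* v → z ≡ suc (z₁ v)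
  z≡1+z₁ {v} (_ , zd) = ≡.trans R′.|Z*|≡count (count-remove R′.ZD*? (second v) zd)

  degree-F*×0 : ∀ {v} → F*×0 v → degree v ≡ u + z
  degree-F*×0 {v} v∈ = ≡.trans
    (count-cong (adj? v) (0×U? ∪? 0×Z*?) (λ l → F*×0-neighbours v∈) (λ l → F*×0-adjacent v∈))
    (≡.trans (count-∪ 0×U? 0×Z*? λ l (_ , unit) (_ , zd) → R′.unit⇒¬ZD* unit zd)
             (≡.cong₂ _+_ count-0×U count-0×Z*))

  degree-0×U : ∀ {v} → 0×U v → degree v ≡ n
  degree-0×U {v} v∈ =
    ≡.trans (count-cong (adj? v) F*×0? (λ l → 0×U-neighbours v∈) (λ l → 0×U-adjacent v∈)) count-F*×0

  degree-0×Z*≥ : ∀ {v} → 0×Z* v → n + (z₁ v + n * z₁ v) ≤ degree v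
  degree-0×Z*≥ {v} v∈ =
    ≤-trans (≤-reflexive (≡.sym counted)) (count-mono _ (adj? v) (λ l → 0×Z*-adjacent v∈))
    where
    column-size : count (U? {A = Fin F.size}) ≡ suc n
    column-size = ≡.trans (count-all U? (λ _ → tt)) F′.size≡1+|nonzero|
    counted : count (F*×0? ∪? U? ⊗? OtherZD*? v) ≡ n + (z₁ v + n * z₁ v)
    counted = ≡.trans (count-∪ F*×0? (U? ⊗? OtherZD*? v) (λ l (_ , d≈0) (_ , zd , _) → proj₁ zd d≈0))
      (≡.cong₂ _+_ count-F*×0 (≡.trans (count-⊗ U? (OtherZD*? v)) (≡.cong (_* z₁ v) column-size)))

  2≤n : 2 ≤ n
  2≤n = ≤-pred (≤-trans 3≤|F| (≤-reflexive F′.size≡1+|nonzero|))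

  1≤n : 1 ≤ n
  1≤n = ≤-trans (s≤s z≤n) 2≤n

  1≤u : 1 ≤ u
  1≤u = R′.1≤|U|

  -- suc g + n / 2 is the paper's 2 + ⌊(u − z)/2⌋ + ⌊n/2⌋, with the integer subtraction
  -- shifted into ℕ (see γ-formula).
  g : ℕ
  g = (u + 2 ∸ z) / 2

  γ : ℕ
  γ = z + (u ⊓ n ⊓ (suc g + n / 2))

  module LowerBound (S : Subset size) (goa : IsGOA S) where

    open ≤-Reasoning

    a b c d : ℕ
    a = ∣ F*×0?  ∩ S ∣
    b = ∣ 0×U?   ∩ S ∣
    c = ∣ 0×Z*?  ∩ S ∣
    d = ∣ F*×Z*? ∩ S ∣

    offensive : ∀ {v} → Vertex v → v ∉ S → suc (δ̄ S v) ≤ δ S v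
    offensive {v} v∈V v∉S = proj₂ (proj₂ goa) v v∈V v∉S

    a≤n : a ≤ n
    a≤n = ≤-trans (∣∩∣≤count F*×0?) (≤-reflexive count-F*×0)

    c≤z : c ≤ z
    c≤z = ≤-trans (∣∩∣≤count 0×Z*?) (≤-reflexive count-0×Z*)

    F*×0-outside : ∀ {v} → F*×0 v → v ∉ S → suc (u + z) ≤ (b + c) + (b + c)
    F*×0-outside {v} v∈ v∉S = begin
      suc (u + z)              ≡⟨ ≡.cong suc (≡.sym (degree-F*×0 v∈)) ⟩
      suc (degree v)           ≤⟨ offensive⇒2δ>degree v (offensive (F*×0⊆Vertex v∈) v∉S) ⟩
      δ S v + δ S v            ≤⟨ +-mono-≤ δ≤b+c δ≤b+c ⟩
      (b + c) + (b + c)        ∎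
      where
      δ≤b+c = ≤-trans (δ≤∣∩∣ (0×U? ∪? 0×Z*?) v (λ l → F*×0-neighbours v∈))
                      (≤-reflexive (∣∪∩∣ 0×U? 0×Z*? λ k (_ , unit) (_ , zd) → R′.unit⇒¬ZD* unit zd))

    0×U-outside : ∀ {v} → 0×U v → v ∉ S → suc n ≤ a + a
    0×U-outside {v} v∈ v∉S = begin
      suc n                    ≡⟨ ≡.cong suc (≡.sym (degree-0×U v∈)) ⟩
      suc (degree v)           ≤⟨ offensive⇒2δ>degree v (offensive (0×U⊆Vertex v∈) v∉S) ⟩
      δ S v + δ S v            ≤⟨ +-mono-≤ δ≤a δ≤a ⟩
      a + a                    ∎
      where δ≤a = δ≤∣∩∣ F*×0? v (λ l → 0×U-neighbours v∈)

    0×Z*-outside : ∀ {v} → 0×Z* v → v ∉ S → suc (n + (z₁ v + n * z₁ v)) ≤ (a + (c + d)) + (a + (c + d))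
    0×Z*-outside {v} v∈ v∉S = begin
      suc (n + (z₁ v + n * z₁ v)) ≤⟨ s≤s (degree-0×Z*≥ v∈) ⟩
      suc (degree v)              ≤⟨ offensive⇒2δ>degree v (offensive (ZD*-second⇒Vertex (proj₂ v∈)) v∉S) ⟩
      δ S v + δ S v               ≤⟨ +-mono-≤ δ≤a+c+d δ≤a+c+d ⟩
      (a + (c + d)) + (a + (c + d)) ∎
      where
      δ≤a+c+d = ≤-trans (δ≤∣∩∣ (F*×0? ∪? 0×Z*? ∪? F*×Z*?) v (λ l → 0×Z*-neighbours v∈))
        (≤-reflexive (≡.trans (∣∪∩∣ F*×0? (0×Z*? ∪? F*×Z*?) λ { k (_ , b≈0) (inj₁ (_ , zd)) → proj₁ zd b≈0
                                                               ; k (_ , b≈0) (inj₂ (_ , zd)) → proj₁ zd b≈0 })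
                              (≡.cong (a +_) (∣∪∩∣ 0×Z*? F*×Z*? λ k (a≈0 , _) (a≉0 , _) → a≉0 a≈0))))

    F*×Z*-outside : ∀ {v} → F*×Z* v → v ∉ S → 1 ≤ c
    F*×Z*-outside {v} v∈ v∉S = ≤-trans (s≤s z≤n)
      (≤-trans (offensive (ZD*-second⇒Vertex (proj₂ v∈)) v∉S) (δ≤∣∩∣ 0×Z*? v (λ l → F*×Z*-neighbours v∈)))

    C∩S=∅⇒z≤d : ¬ 1 ≤ c → z ≤ d
    C∩S=∅⇒z≤d c≱1 with ∣∩∣≡count⊎missing F*×Z*?
    ... | inj₁ d≡count = begin
      z            ≤⟨ m≤n*m z n ⦃ >-nonZero (≤-trans (s≤s z≤n) 2≤n) ⦄ ⟩
      n * z        ≡⟨ ≡.sym (≡.trans d≡count count-F*×Z*) ⟩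
      d            ∎
    ... | inj₂ (w , w∈ , w∉S) = contradiction (F*×Z*-outside w∈ w∉S) c≱1

    3≤z⇒z≤c+d : ∀ {v} → 0×Z* v → v ∉ S → 3 ≤ z → z ≤ c + d
    3≤z⇒z≤c+d {v} v∈ v∉S 3≤z =
      ≤-trans (≤-reflexive (z≡1+z₁ v∈)) (1+n+z+nz≤2[a+x]⇒z<x 2≤n 2≤z₁ a≤n (0×Z*-outside v∈ v∉S))
      where 2≤z₁ = ≤-pred (≤-trans 3≤z (≤-reflexive (z≡1+z₁ v∈)))

    -- Here c = 1, and a vertex of F*×Z* adjacent to v cannot lie outside S: it would have
    -- one neighbour outside S and at most c = 1 inside.
    z≤2⇒z≤c+d : ∀ {v} → 0×Z* v → v ∉ S → 1 ≤ c → z ≤ 2 → z ≤ c + d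
    z≤2⇒z≤c+d {v} v∈ v∉S 1≤c z≤2 =
      let (w , w∈ , w≢v) = 1≤count⇒∃ (∁? F′.Zero? ⊗? OtherZD*? v)
                             (≤-trans (*-mono-≤ 1≤n 1≤z₁) (≤-reflexive (≡.sym count-F*×OtherZD*)))
      in ≤-trans z≤2 (+-mono-≤ 1≤c (∃⇒1≤count (F*×Z*? ∩? (_∈? S)) w ((w∈ , proj₁ w≢v) , inside w w∈ w≢v)))
      where
      c<z : suc c ≤ z
      c<z = ≤-trans (missing⇒∣∩∣<count 0×Z*? v v∈ v∉S) (≤-reflexive count-0×Z*)
      1≤z₁ : 1 ≤ z₁ v
      1≤z₁ = ≤-pred (≤-trans (s≤s 1≤c) (≤-trans c<z (≤-reflexive (z≡1+z₁ v∈))))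
      count-F*×OtherZD* : count (∁? F′.Zero? ⊗? OtherZD*? v) ≡ n * z₁ v
      count-F*×OtherZD* = ≡.trans (count-⊗ (∁? F′.Zero?) (OtherZD*? v)) (≡.cong (_* z₁ v) (≡.sym F′.|nonzero|≡count))
      inside : ∀ w → ∁ F′.Zero (first w) → OtherZD* v (second w) → w ∈ S
      inside w x≉0 (zd , w≢v) with w ∈? S
      ... | yes w∈S = w∈S
      ... | no  w∉S = contradiction (begin-strict
            2                ≤⟨ s≤s (1≤δ̄ w v (F*×Z*-adjacent (x≉0 , zd) v∈ (w≢v ∘ ≡.sym)) v∉S) ⟩
            suc (δ̄ S w)      ≤⟨ offensive (ZD*-second⇒Vertex zd) w∉S ⟩
            δ S w            ≤⟨ δ≤∣∩∣ 0×Z*? w (λ l → F*×Z*-neighbours (x≉0 , zd)) ⟩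
            c                <⟨ c<z ⟩
            z                ≤⟨ z≤2 ⟩
            2                ∎) (<-irrefl ≡.refl)

    z≤c+d : z ≤ c + d
    z≤c+d with ∣∩∣≡count⊎missing 0×Z*?
    ... | inj₁ c≡count = ≤-trans (≤-reflexive (≡.sym (≡.trans c≡count count-0×Z*))) (m≤m+n c d)
    ... | inj₂ (v , v∈ , v∉S) with 1 ≤? c | 3 ≤? z
    ...   | no  c≱1 | _       = ≤-trans (C∩S=∅⇒z≤d c≱1) (m≤n+m d c)
    ...   | yes 1≤c | yes 3≤z = 3≤z⇒z≤c+d v∈ v∉S 3≤z
    ...   | yes 1≤c | no  3≰z = z≤2⇒z≤c+d v∈ v∉S 1≤c (≤-pred (≰⇒> 3≰z))

    M≤a+b : u ⊓ n ⊓ (suc g + n / 2) ≤ a + b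
    M≤a+b with ∣∩∣≡count⊎missing F*×0? | ∣∩∣≡count⊎missing 0×U?
    ... | inj₁ a≡count | _ = begin
      u ⊓ n ⊓ (suc g + n / 2)   ≤⟨ m⊓n≤m _ _ ⟩
      u ⊓ n                     ≤⟨ m⊓n≤n u n ⟩
      n                         ≡⟨ ≡.sym (≡.trans a≡count count-F*×0) ⟩
      a                         ≤⟨ m≤m+n a b ⟩
      a + b                     ∎
    ... | inj₂ _ | inj₁ b≡count = begin
      u ⊓ n ⊓ (suc g + n / 2)   ≤⟨ m⊓n≤m _ _ ⟩
      u ⊓ n                     ≤⟨ m⊓n≤m u n ⟩
      u                         ≡⟨ ≡.sym (≡.trans b≡count count-0×U) ⟩
      b                         ≤⟨ m≤n+m b a ⟩
      a + b                     ∎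
    ... | inj₂ (v , v∈ , v∉S) | inj₂ (w , w∈ , w∉S) = begin
      u ⊓ n ⊓ (suc g + n / 2)   ≤⟨ m⊓n≤n _ _ ⟩
      suc (g + n / 2)           ≡⟨ ≡.cong suc (+-comm g (n / 2)) ⟩
      suc (n / 2) + g           ≤⟨ +-mono-≤ (<2a⇒1+[n/2]≤a {a = a} (0×U-outside w∈ w∉S))
                                            ([u+2∸z]/2≤b {b = b} c≤z (F*×0-outside v∈ v∉S)) ⟩
      a + b                     ∎

    a+b+c+d≤∣S∣ : (a + b) + (c + d) ≤ ∣ S ∣
    a+b+c+d≤∣S∣ = begin
      (a + b) + (c + d)  ≡⟨ ≡.sym (≡.trans (∣∪∩∣ (F*×0? ∪? 0×U?) (0×Z*? ∪? F*×Z*?) disjoint)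
                                           (≡.cong₂ _+_ (∣∪∩∣ F*×0? 0×U? λ k (a≉0 , _) (a≈0 , _) → a≉0 a≈0)
                                                        (∣∪∩∣ 0×Z*? F*×Z*? λ k (a≈0 , _) (a≉0 , _) → a≉0 a≈0))) ⟩
      ∣ (F*×0? ∪? 0×U?) ∪? (0×Z*? ∪? F*×Z*?) ∩ S ∣ ≤⟨ count-mono _ (_∈? S) (λ k → proj₂) ⟩
      count (_∈? S)      ≡⟨ ≡.sym (∣∣≡count S) ⟩
      ∣ S ∣              ∎
      where
      disjoint : ∀ k → (F*×0 ∪ 0×U) k → ¬ (0×Z* ∪ F*×Z*) k
      disjoint k (inj₁ (a≉0 , _)) (inj₁ (a≈0 , _))     = a≉0 a≈0
      disjoint k (inj₁ (_ , b≈0)) (inj₂ (_ , zd))      = proj₁ zd b≈0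
      disjoint k (inj₂ (_ , unit)) (inj₁ (_ , zd))     = R′.unit⇒¬ZD* unit zd
      disjoint k (inj₂ (a≈0 , _)) (inj₂ (a≉0 , _))     = a≉0 a≈0

    γ≤∣S∣ : γ ≤ ∣ S ∣
    γ≤∣S∣ = begin
      z + (u ⊓ n ⊓ (suc g + n / 2))  ≤⟨ +-mono-≤ z≤c+d M≤a+b ⟩
      (c + d) + (a + b)              ≡⟨ +-comm (c + d) (a + b) ⟩
      (a + b) + (c + d)              ≤⟨ a+b+c+d≤∣S∣ ⟩
      ∣ S ∣                          ∎

  module Construction (a′ b′ : ℕ) (a′≤n : a′ ≤ n) (b′≤u : b′ ≤ u)
                      (F*×0-ok : a′ < n → suc (u + z) ≤ (b′ + z) + (b′ + z))
                      (0×U-ok : b′ < u → suc n ≤ a′ + a′)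
                      (1≤a′+b′ : 1 ≤ a′ + b′) where

    open ≤-Reasoning

    A′ B′ : Subset size
    A′ = take F*×0? a′
    B′ = take 0×U? b′

    a′≤count : a′ ≤ count F*×0?
    a′≤count = ≤-trans a′≤n (≤-reflexive (≡.sym count-F*×0))

    b′≤count : b′ ≤ count 0×U?
    b′≤count = ≤-trans b′≤u (≤-reflexive (≡.sym count-0×U))

    InS : Pred (Fin size) 0ℓ
    InS = 0×Z* ∪ (_∈ A′) ∪ (_∈ B′)

    InS? : Decidable InS
    InS? = 0×Z*? ∪? (_∈? A′) ∪? (_∈? B′)

    S : Subset size
    S = subset InS?

    ∣S∣≡z+a′+b′ : ∣ S ∣ ≡ z + (a′ + b′)
    ∣S∣≡z+a′+b′ = begin-equality
      ∣ S ∣                                     ≡⟨ ∣∣≡count S ⟩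
      count (_∈? S)                             ≡⟨ count-cong (_∈? S) InS? (∈-subset⁻ InS?) (∈-subset⁺ InS?) ⟩
      count InS?                                ≡⟨ count-∪ 0×Z*? ((_∈? A′) ∪? (_∈? B′)) 0×Z*∩[A′∪B′]=∅ ⟩
      count 0×Z*? + count ((_∈? A′) ∪? (_∈? B′)) ≡⟨ ≡.cong (count 0×Z*? +_) (count-∪ (_∈? A′) (_∈? B′) A′∩B′=∅) ⟩
      count 0×Z*? + (count (_∈? A′) + count (_∈? B′))
        ≡⟨ ≡.cong₂ _+_ count-0×Z* (≡.cong₂ _+_ (count-take F*×0? a′ a′≤count) (count-take 0×U? b′ b′≤count)) ⟩
      z + (a′ + b′)                             ∎
      where
      0×Z*∩[A′∪B′]=∅ : ∀ k → 0×Z* k → ¬ (k ∈ A′ ⊎ k ∈ B′)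
      0×Z*∩[A′∪B′]=∅ k (_ , zd) (inj₁ k∈A′) = proj₁ zd (proj₂ (take⊆ F*×0? a′ k k∈A′))
      0×Z*∩[A′∪B′]=∅ k (_ , zd) (inj₂ k∈B′) = R′.unit⇒¬ZD* (proj₂ (take⊆ 0×U? b′ k k∈B′)) zd
      A′∩B′=∅ : ∀ k → k ∈ A′ → ¬ k ∈ B′
      A′∩B′=∅ k k∈A′ k∈B′ = proj₁ (take⊆ F*×0? a′ k k∈A′) (proj₁ (take⊆ 0×U? b′ k k∈B′))

    S⊆Vertex : ∀ k → k ∈ S → Vertex k
    S⊆Vertex k k∈S with ∈-subset⁻ InS? k k∈S
    ... | inj₁ (_ , zd)      = ZD*-second⇒Vertex zd
    ... | inj₂ (inj₁ k∈A′)   = F*×0⊆Vertex (take⊆ F*×0? a′ k k∈A′)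
    ... | inj₂ (inj₂ k∈B′)   = 0×U⊆Vertex (take⊆ 0×U? b′ k k∈B′)

    S-nonempty : ∃ (_∈ S)
    S-nonempty = 1≤count⇒∃ (_∈? S) (begin
      1                  ≤⟨ 1≤a′+b′ ⟩
      a′ + b′            ≤⟨ m≤n+m (a′ + b′) z ⟩
      z + (a′ + b′)      ≡⟨ ≡.sym ∣S∣≡z+a′+b′ ⟩
      ∣ S ∣              ≡⟨ ∣∣≡count S ⟩
      count (_∈? S)      ∎)

    F*×0-offensive : ∀ {v} → F*×0 v → v ∉ S → suc (δ̄ S v) ≤ δ S v
    F*×0-offensive {v} v∈ v∉S = 2δ>degree⇒offensive v (begin
      suc (degree v)          ≡⟨ ≡.cong suc (degree-F*×0 v∈) ⟩
      suc (u + z)             ≤⟨ F*×0-ok a′<n ⟩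
      (b′ + z) + (b′ + z)     ≤⟨ +-mono-≤ b′+z≤δ b′+z≤δ ⟩
      δ S v + δ S v           ∎)
      where
      a′<n : a′ < n
      a′<n = ≤-trans (take-missing F*×0? a′≤count v v∈ (v∉S ∘ ∈-subset⁺ InS? v ∘ inj₂ ∘ inj₁)) (≤-reflexive count-F*×0)
      b′+z≤δ : b′ + z ≤ δ S v
      b′+z≤δ = begin
        b′ + z                             ≡⟨ ≡.sym (≡.cong₂ _+_ (count-take 0×U? b′ b′≤count) count-0×Z*) ⟩
        count (_∈? B′) + count 0×Z*?       ≡⟨ ≡.sym (count-∪ (_∈? B′) 0×Z*? λ k k∈B′ (_ , zd) →
                                                R′.unit⇒¬ZD* (proj₂ (take⊆ 0×U? b′ k k∈B′)) zd) ⟩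
        count ((_∈? B′) ∪? 0×Z*?)          ≤⟨ count≤δ ((_∈? B′) ∪? 0×Z*?) v neighbours-in-S ⟩
        δ S v                              ∎
        where
        neighbours-in-S : ∀ l → (l ∈ B′ ⊎ 0×Z* l) → Adj v l × l ∈ S
        neighbours-in-S l (inj₁ l∈B′) =
          F*×0-adjacent v∈ (inj₁ (take⊆ 0×U? b′ l l∈B′)) , ∈-subset⁺ InS? l (inj₂ (inj₂ l∈B′))
        neighbours-in-S l (inj₂ l∈)   = F*×0-adjacent v∈ (inj₂ l∈) , ∈-subset⁺ InS? l (inj₁ l∈)

    0×U-offensive : ∀ {v} → 0×U v → v ∉ S → suc (δ̄ S v) ≤ δ S v
    0×U-offensive {v} v∈ v∉S = 2δ>degree⇒offensive v (begin
      suc (degree v)          ≡⟨ ≡.cong suc (degree-0×U v∈) ⟩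
      suc n                   ≤⟨ 0×U-ok b′<u ⟩
      a′ + a′                 ≤⟨ +-mono-≤ a′≤δ a′≤δ ⟩
      δ S v + δ S v           ∎)
      where
      b′<u : b′ < u
      b′<u = ≤-trans (take-missing 0×U? b′≤count v v∈ (v∉S ∘ ∈-subset⁺ InS? v ∘ inj₂ ∘ inj₂)) (≤-reflexive count-0×U)
      a′≤δ : a′ ≤ δ S v
      a′≤δ = begin
        a′              ≡⟨ ≡.sym (count-take F*×0? a′ a′≤count) ⟩
        count (_∈? A′)  ≤⟨ count≤δ (_∈? A′) v (λ l l∈A′ → 0×U-adjacent v∈ (take⊆ F*×0? a′ l l∈A′) ,
                                                            ∈-subset⁺ InS? l (inj₂ (inj₁ l∈A′))) ⟩
        δ S v           ∎

    F*×Z*-offensive : ∀ {v} → F*×Z* v → suc (δ̄ S v) ≤ δ S v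
    F*×Z*-offensive {v} v∈@(x≉0 , zd) =
      let (l , adj) = vertex-neighbour v (ZD*-second⇒Vertex zd) λ (x²≈0 , _) → x≉0 (F-cancel x≉0 x²≈0)
      in ≤-trans (s≤s (≤-reflexive (δ̄≡0 v λ l adj → ∈-subset⁺ InS? l (inj₁ (F*×Z*-neighbours v∈ adj)))))
                 (1≤δ v l adj (∈-subset⁺ InS? l (inj₁ (F*×Z*-neighbours v∈ adj))))

    S-offensive : ∀ v → Vertex v → v ∉ S → suc (δ̄ S v) ≤ δ S v
    S-offensive v v∈V v∉S with vertex-classes v v∈V
    ... | inj₁ v∈                = F*×0-offensive v∈ v∉S
    ... | inj₂ (inj₁ v∈)         = 0×U-offensive v∈ v∉S
    ... | inj₂ (inj₂ (inj₁ v∈))  = contradiction (∈-subset⁺ InS? v (inj₁ v∈)) v∉S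
    ... | inj₂ (inj₂ (inj₂ v∈))  = F*×Z*-offensive v∈

    S-alliance : IsGOA S
    S-alliance = S⊆Vertex , S-nonempty , S-offensive

  γ-minimal : ∀ S → IsGOA S → γ ≤ ∣ S ∣
  γ-minimal S goa = LowerBound.γ≤∣S∣ S goa

  alliance-of-size-γ : ∀ a′ b′ → a′ ≤ n → b′ ≤ u → (a′ < n → suc (u + z) ≤ (b′ + z) + (b′ + z)) →
                       (b′ < u → suc n ≤ a′ + a′) → 1 ≤ a′ + b′ → a′ + b′ ≡ u ⊓ n ⊓ (suc g + n / 2) →
                       ∃ λ S → IsGOA S × ∣ S ∣ ≡ γ
  alliance-of-size-γ a′ b′ a′≤n b′≤u F*×0-ok 0×U-ok 1≤a′+b′ a′+b′≡M =
    S , S-alliance , ≡.trans ∣S∣≡z+a′+b′ (≡.cong (z +_) a′+b′≡M)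
    where open Construction a′ b′ a′≤n b′≤u F*×0-ok 0×U-ok 1≤a′+b′

  γ-attained : ∃ λ S → IsGOA S × ∣ S ∣ ≡ γ
  γ-attained with ⊓-sel (u ⊓ n) (suc g + n / 2)
  ... | inj₂ M≡g+h = alliance-of-size-γ (suc (n / 2)) g (1+[n/2]≤n 2≤n) ([u+2∸z]/2≤u z 1≤u)
    (λ _ → 1+u+z≤2[[u+2∸z]/2+z] u z) (λ _ → 1+n≤2[1+n/2] n) (s≤s z≤n)
    (≡.trans (≡.cong suc (+-comm (n / 2) g)) (≡.sym M≡g+h))
  ... | inj₁ M≡u⊓n with ⊓-sel u n
  ...   | inj₁ u⊓n≡u = alliance-of-size-γ 0 u z≤n ≤-refl (λ _ → m<m+n (u + z) (≤-trans 1≤u (m≤m+n u z)))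
    (λ u<u → contradiction u<u (<-irrefl ≡.refl)) 1≤u (≡.sym (≡.trans M≡u⊓n u⊓n≡u))
  ...   | inj₂ u⊓n≡n = alliance-of-size-γ n 0 ≤-refl z≤n (λ n<n → contradiction n<n (<-irrefl ≡.refl))
    (λ _ → m<m+n n 1≤n) (≤-trans 1≤n (m≤m+n n 0)) (≡.trans (+-identityʳ n) (≡.sym (≡.trans M≡u⊓n u⊓n≡n)))

  γ-formula : ℤ.+ γ ≡ ℤ.+ z ℤ.+ ((ℤ.+ u ℤ.⊓ ℤ.+ n) ℤ.⊓ (ℤ.+ 2 ℤ.+ ((ℤ.+ u ℤ.- ℤ.+ z) ℤ./ℕ 2) ℤ.+ (ℤ.+ n ℤ./ℕ 2)))
  γ-formula = ≡.cong (λ t → ℤ.+ z ℤ.+ ((ℤ.+ u ℤ.⊓ ℤ.+ n) ℤ.⊓ (t ℤ.+ (ℤ.+ n ℤ./ℕ 2))))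
    (≡.sym (≡.trans (≡.cong (λ t → ℤ.+ 2 ℤ.+ (t ℤ./ℕ 2)) (u-z≡[u+2∸z]⊖2 |Z*|≤|U|+2)) (2+[w⊖2]/2≡1+w/2 (u + 2 ∸ z))))

open import Data.Integer using (ℤ; +_; _+_; _-_; _⊓_; _/ℕ_)
open import Data.Product using (∃; _×_; _,_)
open import Relation.Binary.PropositionalEquality using (_≡_)

theorem2p10 : (R F : FinCommRing) → FinCommRing.ΓComplete R → IsField F
    → 3 ≤ FinCommRing.size F
    → ∃ λ (m : ℕ) → FinCommRing.γᵒ≡ (F ×R R) m
        × (+ m ≡ + FinCommRing.|Z*| R
             + ((+ FinCommRing.|U| R ⊓ + FinCommRing.|nonzero| F)
                ⊓ (+ 2 + ((+ FinCommRing.|U| R - + FinCommRing.|Z*| R) /ℕ 2)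
                       + (+ FinCommRing.|nonzero| F /ℕ 2))))
theorem2p10 R F complete F-field 3≤|F| = γ , (γ-attained , γ-minimal) , γ-formula
  where open ProductGraph F R F-field 3≤|F| complete
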